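{- Let $\pi\in S_n$ avoid both $1432$ and $2143$. If $(i,j_1),(i,j_2)\in\mathrm{Ess}(\pi)$ with $j_1<j_2$ and $(i,j_1)$ not in the dominant region, then $(i',j_1)\notin\mathrm{Ess}(\pi)$ for every $i'>i$. Similarly, if $(i_1,j),(i_2,j)\in\mathrm{Ess}(\pi)$ with $i_1<i_2$ and $(i_1,j)$ not in the dominant region, then $(i_1,j')\notin\mathrm{Ess}(\pi)$ for every $j'>j$.
   Context: $\pi$ avoids $1432$ if there are no indices $a<b<c<d$ with $\pi(a)<\pi(d)<\pi(c)<\pi(b)$; $\pi$ avoids $2143$ if there are no $a<b<c<d$ with $\pi(b)<\pi(a)<\pi(d)<\pi(c)$. The Rothe diagram of $\pi$ is $R(\pi)=\{(i,j)\in[n]^2:\ \pi(i)>j,\ \pi^{ -1}(j)>i\}$ ($i$ row index, $j$ column index). Connected components are with respect to edge-adjacency; the dominant region is the component containing $(1,1)$ (empty if $(1,1)\notin R(\pi)$). The set of essential boxes $\mathrm{Ess}(\pi)$ consists of the cells $(i,j)\in R(\pi)$ with $(i+1,j)\notin R(\pi)$ and $(i,j+1)\notin R(\pi)$ (the south-east-most corners of the components). -}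

module Defs where

open import Data.Nat using (ℕ; suc)
open import Data.Fin using (Fin; toℕ; _<_)
open import Data.Fin.Permutation using (Permutation′; _⟨$⟩ʳ_; _⟨$⟩ˡ_)
open import Data.Product using (Σ; ∃; _×_; _,_)
open import Data.Sum using (_⊎_)
open import Relation.Binary.PropositionalEquality using (_≡_)
open import Relation.Nullary using (¬_)

-- Positions and values are Fin n (0-based; only the order matters).
-- π ⟨$⟩ʳ i is π(i), π ⟨$⟩ˡ j is π⁻¹(j).

Contains1432 : ∀ {n} → Permutation′ n → Set
Contains1432 {n} π =
  Σ (Fin n) λ a → Σ (Fin n) λ b → Σ (Fin n) λ c → Σ (Fin n) λ d →
    (a < b) × (b < c) × (c < d) ×
    (π ⟨$⟩ʳ a < π ⟨$⟩ʳ d) × (π ⟨$⟩ʳ d < π ⟨$⟩ʳ c) × (π ⟨$⟩ʳ c < π ⟨$⟩ʳ b)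

Avoids1432 : ∀ {n} → Permutation′ n → Set
Avoids1432 π = ¬ Contains1432 π

Contains2143 : ∀ {n} → Permutation′ n → Set
Contains2143 {n} π =
  Σ (Fin n) λ a → Σ (Fin n) λ b → Σ (Fin n) λ c → Σ (Fin n) λ d →
    (a < b) × (b < c) × (c < d) ×
    (π ⟨$⟩ʳ b < π ⟨$⟩ʳ a) × (π ⟨$⟩ʳ a < π ⟨$⟩ʳ d) × (π ⟨$⟩ʳ d < π ⟨$⟩ʳ c)

Avoids2143 : ∀ {n} → Permutation′ n → Set
Avoids2143 π = ¬ Contains2143 π

InRothe : ∀ {n} → Permutation′ n → Fin n → Fin n → Set
InRothe π i j = (j < π ⟨$⟩ʳ i) × (i < π ⟨$⟩ˡ j)

Adjacent : ∀ {n} → Fin n → Fin n → Fin n → Fin n → Set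
Adjacent i j i' j' =
  (i ≡ i' × (suc (toℕ j) ≡ toℕ j' ⊎ suc (toℕ j') ≡ toℕ j)) ⊎
  (j ≡ j' × (suc (toℕ i) ≡ toℕ i' ⊎ suc (toℕ i') ≡ toℕ i))

data Connected {n} (π : Permutation′ n) (i j : Fin n) : Fin n → Fin n → Set where
  here : InRothe π i j → Connected π i j i j
  step : ∀ {k l k' l'} → Connected π i j k l → InRothe π k' l' →
         Adjacent k l k' l' → Connected π i j k' l'

-- Dominant region: the component of R(π) containing (1,1)
-- (0-based: the cell (0,0)); empty if that cell is not in R(π).
InDominant : ∀ {n} → Permutation′ n → Fin n → Fin n → Set
InDominant {n} π i j = Σ (Fin n) λ z → (toℕ z ≡ 0) × Connected π z z i j

-- Essential boxes: (i,j) ∈ R(π), (i+1,j) ∉ R(π), (i,j+1) ∉ R(π)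
-- (a cell outside [n]² is not in R(π)).
IsEssential : ∀ {n} → Permutation′ n → Fin n → Fin n → Set
IsEssential {n} π i j =
  InRothe π i j ×
  (∀ (i' : Fin n) → toℕ i' ≡ suc (toℕ i) → ¬ InRothe π i' j) ×
  (∀ (j' : Fin n) → toℕ j' ≡ suc (toℕ j) → ¬ InRothe π i j')

{-# OPTIONS --safe #-}
-- Off the dominant region some k < i has π(k) < j₁, since otherwise the whole
-- rectangle [0,i] × [0,j₁] lies in R(π). Essentiality of (i,j₁) together with
-- (i,j₂) and (i',j₁) in R(π) forces π(i+1) < j₁ and a = π⁻¹(j₁+1) < i, hence
-- j₁+1 < j₂. With p = π⁻¹(j₁) and q = π⁻¹(j₂): if q < p then k i q p is a 1432,
-- if π(i') < π(i) then k i i' p is a 1432, and otherwise a (i+1) i' q is a 2143.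
-- The column statement is the row statement for π⁻¹.
module Submission where

open import Defs
open import Data.Nat using (ℕ; suc; z≤n) renaming (_<_ to _<ℕ_; _≤_ to _≤ℕ_)
import Data.Nat.Properties as ℕ
open import Data.Fin using (Fin; zero; toℕ; fromℕ<; inject₁; _<_; _≤_; _<?_; _≤?_)
open import Data.Fin.Properties
  using (toℕ-fromℕ<; toℕ-inject₁; toℕ<n; ≤̄⇒inject₁<; ≤∧≢⇒<; <⇒≢; any?)
open import Data.Fin.Induction using (<-weakInduction)
open import Data.Fin.Permutation using (Permutation′; _⟨$⟩ʳ_; _⟨$⟩ˡ_; inverseʳ; flip)
open import Data.Product using (_×_; _,_; ∃; swap)
open import Data.Sum using (inj₁; inj₂)
open import Data.Empty using (⊥; ⊥-elim)
open import Function using (Inverse; _∘_)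
open import Relation.Nullary using (¬_; yes; no)
open import Relation.Nullary.Decidable using (_×-dec_)
open import Relation.Binary.PropositionalEquality using (_≡_; refl; sym; cong; subst; subst₂)

module _ {n : ℕ} (π : Permutation′ n) where

  ¬InRothe⇒ʳ< : ∀ {i j} → i < π ⟨$⟩ˡ j → ¬ InRothe π i j → π ⟨$⟩ʳ i < j
  ¬InRothe⇒ʳ< i<πˡj ∉R =
    ≤∧≢⇒< (ℕ.≮⇒≥ (λ j<πi → ∉R (j<πi , i<πˡj)))
          (λ πi≡j → <⇒≢ i<πˡj (sym (Inverse.inverseʳ π (sym πi≡j))))

  successor : ∀ {i i' : Fin n} → i < i' → ∃ λ s → toℕ s ≡ suc (toℕ i) × i < s × s ≤ i'
  successor {i} {i'} i<i' = fromℕ< i+1<n , s≡i+1 , subst (toℕ i <ℕ_) (sym s≡i+1) ℕ.≤-refl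
                                          , subst (_≤ℕ toℕ i') (sym s≡i+1) i<i'
    where
    i+1<n : suc (toℕ i) <ℕ n
    i+1<n = ℕ.≤-<-trans i<i' (toℕ<n i')
    s≡i+1 : toℕ (fromℕ< i+1<n) ≡ suc (toℕ i)
    s≡i+1 = toℕ-fromℕ< i+1<n

  essential⇒row-below : ∀ {i j i'} → IsEssential π i j → i < i' → i' < π ⟨$⟩ˡ j →
                        ∃ λ s → i < s × s ≤ i' × π ⟨$⟩ʳ s < j
  essential⇒row-below (_ , below , _) i<i' i'<πˡj with successor i<i'
  ... | s , s≡i+1 , i<s , s≤i' =
    s , i<s , s≤i' , ¬InRothe⇒ʳ< (ℕ.≤-<-trans s≤i' i'<πˡj) (below s s≡i+1)

IsEssential-flip : ∀ {n} (π : Permutation′ n) {i j} → IsEssential π i j → IsEssential (flip π) j i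
IsEssential-flip π (R , below , right) =
  swap R , (λ j' e → right j' e ∘ swap) , (λ i' e → below i' e ∘ swap)

essential⇒column-right : ∀ {n} (π : Permutation′ n) {i j j'} → IsEssential π i j → j < j' →
                         j' < π ⟨$⟩ʳ i → ∃ λ t → j < t × t ≤ j' × π ⟨$⟩ˡ t < i
essential⇒column-right π ess = essential⇒row-below (flip π) (IsEssential-flip π ess)

module _ {m : ℕ} (π : Permutation′ (suc m)) {i j : Fin (suc m)}
         (large : ∀ k → k ≤ i → j < π ⟨$⟩ʳ k) where

  InRothe-rectangle : ∀ {r c} → r ≤ i → c ≤ j → InRothe π r c
  InRothe-rectangle {r} {c} r≤i c≤j = ℕ.≤-<-trans c≤j (large r r≤i) , r<πˡc
    where
    r<πˡc : r < π ⟨$⟩ˡ c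
    r<πˡc = ℕ.≰⇒> λ πˡc≤r →
      ℕ.<-irrefl refl (ℕ.<-≤-trans (subst (j <_) (inverseʳ π) (large _ (ℕ.≤-trans πˡc≤r r≤i))) c≤j)

  rectangle-row-connected : ∀ c → c ≤ j → Connected π zero zero zero c
  rectangle-row-connected = <-weakInduction _ (λ _ → here (InRothe-rectangle z≤n z≤n))
    λ c left c+1≤j → step (left (ℕ.<⇒≤ (ℕ.<-≤-trans (≤̄⇒inject₁< ℕ.≤-refl) c+1≤j)))
                          (InRothe-rectangle z≤n c+1≤j)
                          (inj₁ (refl , inj₁ (cong suc (toℕ-inject₁ c))))

  rectangle-connected : ∀ r → r ≤ i → Connected π zero zero r j
  rectangle-connected = <-weakInduction _ (λ _ → rectangle-row-connected j ℕ.≤-refl)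
    λ r above r+1≤i → step (above (ℕ.<⇒≤ (ℕ.<-≤-trans (≤̄⇒inject₁< ℕ.≤-refl) r+1≤i)))
                           (InRothe-rectangle r+1≤i ℕ.≤-refl)
                           (inj₂ (refl , inj₁ (cong suc (toℕ-inject₁ r))))

  rectangle⇒InDominant : InDominant π i j
  rectangle⇒InDominant = zero , refl , rectangle-connected i ℕ.≤-refl

¬InDominant⇒smaller-above : ∀ {n} (π : Permutation′ n) {i j} → InRothe π i j → ¬ InDominant π i j →
                            ∃ λ k → k < i × π ⟨$⟩ʳ k < j
¬InDominant⇒smaller-above {suc m} π {i} {j} (j<πi , i<πˡj) ¬dom
  with any? (λ k → (k ≤? i) ×-dec (π ⟨$⟩ʳ k <? j))
... | yes (k , k≤i , πk<j) = k , ≤∧≢⇒< k≤i (λ { refl → ℕ.<-asym πk<j j<πi }) , πk<j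
... | no ∄k = ⊥-elim (¬dom (rectangle⇒InDominant π large))
  where
  large : ∀ k → k ≤ i → j < π ⟨$⟩ʳ k
  large k k≤i = ≤∧≢⇒< (ℕ.≮⇒≥ (λ πk<j → ∄k (k , k≤i , πk<j)))
                      (λ j≡πk → <⇒≢ (ℕ.≤-<-trans k≤i i<πˡj) (sym (Inverse.inverseʳ π j≡πk)))

module _ {n : ℕ} (π : Permutation′ n) where

  Connected-flip : ∀ {a b c d} → Connected (flip π) a b c d → Connected π b a d c
  Connected-flip (here R) = here (swap R)
  Connected-flip (step path R (inj₁ adj)) = step (Connected-flip path) (swap R) (inj₂ adj)
  Connected-flip (step path R (inj₂ adj)) = step (Connected-flip path) (swap R) (inj₁ adj)

  InDominant-flip : ∀ {i j} → InDominant (flip π) j i → InDominant π i j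
  InDominant-flip (z , z≡0 , path) = z , z≡0 , Connected-flip path

  ˡ-values : ∀ {a b} → a < b → π ⟨$⟩ʳ (π ⟨$⟩ˡ a) < π ⟨$⟩ʳ (π ⟨$⟩ˡ b)
  ˡ-values = subst₂ _<_ (sym (inverseʳ π)) (sym (inverseʳ π))

  -- 1432 and 2143 are involutions, so an occurrence in π⁻¹ is one in π.
  Avoids1432-flip : Avoids1432 π → Avoids1432 (flip π)
  Avoids1432-flip avoids (a , b , c , d , a<b , b<c , c<d , x , y , z) =
    avoids (π ⟨$⟩ˡ a , π ⟨$⟩ˡ d , π ⟨$⟩ˡ c , π ⟨$⟩ˡ b , x , y , z ,
            ˡ-values a<b , ˡ-values b<c , ˡ-values c<d)

  Avoids2143-flip : Avoids2143 π → Avoids2143 (flip π)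
  Avoids2143-flip avoids (a , b , c , d , a<b , b<c , c<d , x , y , z) =
    avoids (π ⟨$⟩ˡ b , π ⟨$⟩ˡ a , π ⟨$⟩ˡ d , π ⟨$⟩ˡ c , x , y , z ,
            ˡ-values a<b , ˡ-values b<c , ˡ-values c<d)

essential-row-pair⇒¬IsEssential-below :
  ∀ {n} (π : Permutation′ n) → Avoids1432 π → Avoids2143 π → ∀ {i j₁ j₂ i'} →
  IsEssential π i j₁ → IsEssential π i j₂ → j₁ < j₂ → ¬ InDominant π i j₁ →
  i < i' → ¬ IsEssential π i' j₁
essential-row-pair⇒¬IsEssential-below π avoids1432 avoids2143 {i} {j₁} {j₂} {i'}
  ess₁@(Rij₁ , _ , _) ((j₂<πi , i<q) , _ , _) j₁<j₂ ¬dom i<i' ((j₁<πi' , i'<p) , _ , _)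
  with ¬InDominant⇒smaller-above π Rij₁ ¬dom
     | essential⇒row-below π ess₁ i<i' i'<p
     | essential⇒column-right π ess₁ j₁<j₂ j₂<πi
... | k , k<i , πk<j₁ | s , i<s , s≤i' , πs<j₁ | t , j₁<t , t≤j₂ , a<i = contradiction
  where
  p q a : Fin _
  p = π ⟨$⟩ˡ j₁
  q = π ⟨$⟩ˡ j₂
  a = π ⟨$⟩ˡ t

  s<i' : s < i'
  s<i' = ≤∧≢⇒< s≤i' λ { refl → ℕ.<-asym πs<j₁ j₁<πi' }

  t<j₂ : t < j₂
  t<j₂ = ≤∧≢⇒< t≤j₂ λ { refl → <⇒≢ (ℕ.<-trans a<i i<q) refl }

  πp≡j₁ : π ⟨$⟩ʳ p ≡ j₁
  πp≡j₁ = inverseʳ π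

  πq≡j₂ : π ⟨$⟩ʳ q ≡ j₂
  πq≡j₂ = inverseʳ π

  πk<πp : π ⟨$⟩ʳ k < π ⟨$⟩ʳ p
  πk<πp = subst (π ⟨$⟩ʳ k <_) (sym πp≡j₁) πk<j₁

  πp<πq : π ⟨$⟩ʳ p < π ⟨$⟩ʳ q
  πp<πq = subst₂ _<_ (sym πp≡j₁) (sym πq≡j₂) j₁<j₂

  πq<πi : π ⟨$⟩ʳ q < π ⟨$⟩ʳ i
  πq<πi = subst (_< π ⟨$⟩ʳ i) (sym πq≡j₂) j₂<πi

  πp<πi' : π ⟨$⟩ʳ p < π ⟨$⟩ʳ i'
  πp<πi' = subst (_< π ⟨$⟩ʳ i') (sym πp≡j₁) j₁<πi'

  πs<πa : π ⟨$⟩ʳ s < π ⟨$⟩ʳ a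
  πs<πa = subst (π ⟨$⟩ʳ s <_) (sym (inverseʳ π)) (ℕ.<-trans πs<j₁ j₁<t)

  πa<πq : π ⟨$⟩ʳ a < π ⟨$⟩ʳ q
  πa<πq = ˡ-values π t<j₂

  contradiction : ⊥
  contradiction with q <? p
  ... | yes q<p = avoids1432 (k , i , q , p , k<i , i<q , q<p , πk<πp , πp<πq , πq<πi)
  ... | no q≮p with π ⟨$⟩ʳ i' <? π ⟨$⟩ʳ i
  ...   | yes πi'<πi = avoids1432 (k , i , i' , p , k<i , i<i' , i'<p , πk<πp , πp<πi' , πi'<πi)
  ...   | no πi'≮πi = avoids2143 (a , s , i' , q , ℕ.<-trans a<i i<s , s<i' ,
                                  ℕ.<-≤-trans i'<p (ℕ.≮⇒≥ q≮p) , πs<πa , πa<πq ,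
                                  ℕ.<-≤-trans πq<πi (ℕ.≮⇒≥ πi'≮πi))

lemma5p18 : (n : ℕ) (π : Permutation′ n) → Avoids1432 π → Avoids2143 π →
    ((i j₁ j₂ : Fin n) → IsEssential π i j₁ → IsEssential π i j₂ → j₁ < j₂ →
      ¬ InDominant π i j₁ → (i' : Fin n) → i < i' → ¬ IsEssential π i' j₁)
    ×
    ((i₁ i₂ j : Fin n) → IsEssential π i₁ j → IsEssential π i₂ j → i₁ < i₂ →
      ¬ InDominant π i₁ j → (j' : Fin n) → j < j' → ¬ IsEssential π i₁ j')
lemma5p18 n π avoids1432 avoids2143 =
  (λ i j₁ j₂ ess₁ ess₂ j₁<j₂ ¬dom i' →
     essential-row-pair⇒¬IsEssential-below π avoids1432 avoids2143 ess₁ ess₂ j₁<j₂ ¬dom) ,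
  (λ i₁ i₂ j ess₁ ess₂ i₁<i₂ ¬dom j' j<j' ess₃ →
     essential-row-pair⇒¬IsEssential-below (flip π)
       (Avoids1432-flip π avoids1432) (Avoids2143-flip π avoids2143)
       (IsEssential-flip π ess₁) (IsEssential-flip π ess₂) i₁<i₂ (¬dom ∘ InDominant-flip π)
       j<j' (IsEssential-flip π ess₃))
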